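{- Let $\mathscr{S}$ be a numerical semigroup. Then $\operatorname{ULF}(\mathscr{S})=\operatorname{Ap}(\mathscr{S},\operatorname{UBetti}(\mathscr{S}))$.
   Context: A numerical semigroup is a submonoid $\mathscr{S}$ of $(\mathbb{N},+)$ with finite complement in $\mathbb{N}=\{0,1,2,\dots\}$; let $\{n_1,\dots,n_e\}$ be its minimal generating set. For $r\in\mathscr{S}$, $\operatorname{F}(r,\mathscr{S})=\{(a_1,\dots,a_e)\in\mathbb{N}^e:a_1n_1+\dots+a_en_e=r\}$ is the set of factorizations of $r$; the length of a factorization $z$ is $|z|=a_1+\dots+a_e$; $\operatorname{L}(r,\mathscr{S})=\{|z|:z\in\operatorname{F}(r,\mathscr{S})\}$; $\operatorname{ULF}(\mathscr{S})=\{r\in\mathscr{S}:\operatorname{L}(r,\mathscr{S})\text{ has exactly one element}\}$. For $r\in\mathscr{S}$, let $\nabla_r$ be the graph with vertex set $\operatorname{F}(r,\mathscr{S})$ in which two vertices are joined by an edge if their dot product is nonzero (they have common support); $r$ is a Betti element if $\nabla_r$ is not connected. $\operatorname{Betti}(\mathscr{S})$ is the set of Betti elements, $\operatorname{BBetti}(\mathscr{S})=\operatorname{Betti}(\mathscr{S})\cap\operatorname{ULF}(\mathscr{S})$ and $\operatorname{UBetti}(\mathscr{S})=\operatorname{Betti}(\mathscr{S})\setminus\operatorname{BBetti}(\mathscr{S})$. For $X\subseteq\mathscr{S}\setminus\{0\}$, $\operatorname{Ap}(\mathscr{S},X)=\mathscr{S}\setminus(X+\mathscr{S})=\{s\in\mathscr{S}:s-x\notin\mathscr{S}\text{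 for all }x\in X\}$; in particular $\operatorname{Ap}(\mathscr{S},\emptyset)=\mathscr{S}$. -}

module Defs where

open import Data.Nat using (ℕ; zero; suc; _+_; _*_; _≤_)
open import Data.Fin using (Fin; zero; suc)
open import Data.Product using (Σ; ∃; _×_; _,_)
open import Relation.Binary.PropositionalEquality using (_≡_; _≢_)
open import Relation.Nullary using (¬_)

-- A sequence of e natural numbers (generators n₁,…,n_e, or an exponent vector).
Vecℕ : ℕ → Set
Vecℕ e = Fin e → ℕ

sumFin : ∀ {e} → (Fin e → ℕ) → ℕ
sumFin {zero}  f = 0
sumFin {suc e} f = f zero + sumFin (λ i → f (suc i))

dot : ∀ {e} → Vecℕ e → Vecℕ e → ℕ
dot a n = sumFin (λ i → a i * n i)

len : ∀ {e} → Vecℕ e → ℕ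
len a = sumFin a

module _ {e : ℕ} (n : Vecℕ e) where

  IsFact : ℕ → Vecℕ e → Set
  IsFact r a = dot a n ≡ r

  InS : ℕ → Set
  InS r = ∃ λ a → IsFact r a

  -- n is a minimal generating system: no n_i lies in the monoid generated by the others
  -- (this also forces every n_i ≠ 0 and the n_i pairwise distinct)
  Minimal : Set
  Minimal = ∀ i → ¬ (∃ λ a → a i ≡ 0 × IsFact (n i) a)

  Cofinite : Set
  Cofinite = ∃ λ F → ∀ x → F ≤ x → InS x

  IsNumericalSemigroupMinGens : Set
  IsNumericalSemigroupMinGens = Minimal × Cofinite

  -- paths in the graph ∇_r (vertices F(r,S), edges between factorizations with nonzero dot product)
  data Path (r : ℕ) : Vecℕ e → Vecℕ e → Set where
    here : ∀ {a} → Path r a a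
    step : ∀ {a b c} → IsFact r b → dot a b ≢ 0 → Path r b c → Path r a c

  Connected : ℕ → Set
  Connected r = ∀ a b → IsFact r a → IsFact r b → Path r a b

  Betti : ℕ → Set
  Betti r = InS r × ¬ Connected r

  ULF : ℕ → Set
  ULF r = InS r × (∀ a b → IsFact r a → IsFact r b → len a ≡ len b)

  BBetti : ℕ → Set
  BBetti r = Betti r × ULF r

  UBetti : ℕ → Set
  UBetti r = Betti r × ¬ ULF r

  Ap : (ℕ → Set) → ℕ → Set
  Ap X s = InS s × (∀ x → X x → ¬ (∃ λ t → InS t × s ≡ x + t))

{-# OPTIONS --safe #-}
-- Factorization length is additive, so if every factorization of r has the
-- same length then the same holds for every x with r - x ∈ S; in particular
-- no element of UBetti divides r.  Conversely, suppose no element of UBetti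
-- divides r, and show by strong induction that every divisor s of r has a
-- unique factorization length.  Two factorizations of s sharing a generator
-- n_j have the same length, by induction applied to s - n_j; so if s had
-- factorizations of different lengths, ∇_s would be disconnected, making s an
-- element of UBetti dividing r.
module Submission where

open import Defs
open import Data.Nat using (ℕ; zero; suc; _+_; _*_; _∸_; _<_; z<s; _≟_)
open import Data.Nat.Properties
open import Data.Nat.Induction using (<-rec)
open import Algebra.Properties.CommutativeSemigroup +-commutativeSemigroup using (interchange)
open import Data.Fin as Fin using (Fin; zero; suc)
open import Data.Product using (∃; _×_; _,_; proj₂; map)
open import Function using (_∘_; id)
open import Relation.Nullary using (contradiction)
open import Relation.Nullary.Decidable using (decidable-stable)
open import Relation.Binary.PropositionalEquality

sumFin-cong : ∀ {e} {f g : Fin e → ℕ} → f ≗ g → sumFin f ≡ sumFin g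
sumFin-cong {zero}  f≗g = refl
sumFin-cong {suc e} f≗g = cong₂ _+_ (f≗g zero) (sumFin-cong (f≗g ∘ suc))

sumFin-+ : ∀ {e} (f g : Fin e → ℕ) → sumFin (λ i → f i + g i) ≡ sumFin f + sumFin g
sumFin-+ {zero}  f g = refl
sumFin-+ {suc e} f g = trans (cong (f zero + g zero +_) (sumFin-+ (f ∘ suc) (g ∘ suc)))
                             (interchange (f zero) (g zero) _ _)

sumFin-0 : ∀ {e} → sumFin {e} (λ _ → 0) ≡ 0
sumFin-0 {zero}  = refl
sumFin-0 {suc e} = sumFin-0 {e}

_⊕_ : ∀ {e} → Vecℕ e → Vecℕ e → Vecℕ e
(a ⊕ b) i = a i + b i

_⊖_ : ∀ {e} → Vecℕ e → Vecℕ e → Vecℕ e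
(a ⊖ b) i = a i ∸ b i

0ᵥ : ∀ {e} → Vecℕ e
0ᵥ _ = 0

basis : ∀ {e} → Fin e → Vecℕ e
basis zero    zero    = 1
basis zero    (suc i) = 0
basis (suc j) zero    = 0
basis (suc j) (suc i) = basis j i

dot-0ᵥ : ∀ {e} (w : Vecℕ e) → dot 0ᵥ w ≡ 0
dot-0ᵥ {e} w = sumFin-0 {e}

dot-⊕ : ∀ {e} (a b w : Vecℕ e) → dot (a ⊕ b) w ≡ dot a w + dot b w
dot-⊕ a b w = trans (sumFin-cong (λ i → *-distribʳ-+ (w i) (a i) (b i)))
                    (sumFin-+ (λ i → a i * w i) (λ i → b i * w i))

len-⊕ : ∀ {e} (a b : Vecℕ e) → len (a ⊕ b) ≡ len a + len b
len-⊕ = sumFin-+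

dot-basis : ∀ {e} (j : Fin e) (w : Vecℕ e) → dot (basis j) w ≡ w j
dot-basis {suc e} zero    w = trans (cong (w zero + 0 +_) (sumFin-0 {e}))
                                    (trans (+-identityʳ _) (+-identityʳ _))
dot-basis {suc e} (suc j) w = dot-basis j (w ∘ suc)

len-basis : ∀ {e} (j : Fin e) → len (basis j) ≡ 1
len-basis j = trans (sumFin-cong (sym ∘ *-identityʳ ∘ basis j)) (dot-basis j (λ _ → 1))

⊖-basis-⊕-basis : ∀ {e} (a : Vecℕ e) (j : Fin e) → 0 < a j → a ≗ (a ⊖ basis j) ⊕ basis j
⊖-basis-⊕-basis a zero    a₀>0 zero    = sym (m∸n+n≡m a₀>0)
⊖-basis-⊕-basis a zero    a₀>0 (suc i) = sym (+-identityʳ _)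
⊖-basis-⊕-basis a (suc j) aⱼ>0 zero    = sym (+-identityʳ _)
⊖-basis-⊕-basis a (suc j) aⱼ>0 (suc i) = ⊖-basis-⊕-basis (a ∘ suc) j aⱼ>0 i

dot-⊖-basis : ∀ {e} (a w : Vecℕ e) (j : Fin e) → 0 < a j →
              dot a w ≡ dot (a ⊖ basis j) w + w j
dot-⊖-basis a w j aⱼ>0 = begin
  dot a w                                 ≡⟨ sumFin-cong (cong (λ m → m * w _) ∘ ⊖-basis-⊕-basis a j aⱼ>0) ⟩
  dot ((a ⊖ basis j) ⊕ basis j) w         ≡⟨ dot-⊕ (a ⊖ basis j) (basis j) w ⟩
  dot (a ⊖ basis j) w + dot (basis j) w   ≡⟨ cong (dot (a ⊖ basis j) w +_) (dot-basis j w) ⟩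
  dot (a ⊖ basis j) w + w j               ∎
  where open ≡-Reasoning

len-⊖-basis : ∀ {e} (a : Vecℕ e) (j : Fin e) → 0 < a j → len a ≡ len (a ⊖ basis j) + 1
len-⊖-basis a j aⱼ>0 = begin
  len a                                   ≡⟨ sumFin-cong (⊖-basis-⊕-basis a j aⱼ>0) ⟩
  len ((a ⊖ basis j) ⊕ basis j)           ≡⟨ len-⊕ (a ⊖ basis j) (basis j) ⟩
  len (a ⊖ basis j) + len (basis j)       ≡⟨ cong (len (a ⊖ basis j) +_) (len-basis j) ⟩
  len (a ⊖ basis j) + 1                   ∎
  where open ≡-Reasoning

shared-support : ∀ {e} (a b : Vecℕ e) → dot a b ≢ 0 → ∃ λ j → 0 < a j × 0 < b j
shared-support {zero}  a b ab≢0 = contradiction refl ab≢0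
shared-support {suc e} a b ab≢0 with a zero in a₀≡ | b zero in b₀≡
... | suc _ | suc _ = zero , subst (0 <_) (sym a₀≡) z<s , subst (0 <_) (sym b₀≡) z<s
... | zero  | _     = map Fin.suc id (shared-support (a ∘ suc) (b ∘ suc) ab≢0)
... | suc m | zero  = map Fin.suc id (shared-support (a ∘ suc) (b ∘ suc)
                                        (ab≢0 ∘ trans (cong (_+ dot (a ∘ suc) (b ∘ suc)) (*-zeroʳ (suc m)))))

module _ {e} (n : Vecℕ e) where

  infix 4 _≼_

  _≼_ : ℕ → ℕ → Set
  x ≼ y = ∃ λ t → InS n t × y ≡ x + t

  IsFact-⊕ : ∀ {x y} a b → IsFact n x a → IsFact n y b → IsFact n (x + y) (a ⊕ b)
  IsFact-⊕ a b fa fb = trans (dot-⊕ a b n) (cong₂ _+_ fa fb)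

  InS-0 : InS n 0
  InS-0 = 0ᵥ , dot-0ᵥ n

  InS-+ : ∀ {x y} → InS n x → InS n y → InS n (x + y)
  InS-+ (a , fa) (b , fb) = a ⊕ b , IsFact-⊕ a b fa fb

  InS-generator : ∀ j → InS n (n j)
  InS-generator j = basis j , dot-basis j n

  ≼-refl : ∀ {x} → x ≼ x
  ≼-refl {x} = 0 , InS-0 , sym (+-identityʳ x)

  ≼-trans : ∀ {x y z} → x ≼ y → y ≼ z → x ≼ z
  ≼-trans {x} (t , t∈S , y≡x+t) (u , u∈S , z≡y+u) =
    t + u , InS-+ t∈S u∈S , trans z≡y+u (trans (cong (_+ u) y≡x+t) (+-assoc x t u))

  Minimal⇒generators-pos : Minimal n → ∀ j → 0 < n j
  Minimal⇒generators-pos minimal j = n≢0⇒n>0 λ nⱼ≡0 →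
    minimal j (0ᵥ , refl , trans (dot-0ᵥ n) (sym nⱼ≡0))

  EqualLengths : ℕ → Set
  EqualLengths s = ∀ a b → IsFact n s a → IsFact n s b → len a ≡ len b

  AdjacentEqualLengths : ℕ → Set
  AdjacentEqualLengths s = ∀ a b → IsFact n s a → IsFact n s b → dot a b ≢ 0 → len a ≡ len b

  EqualLengths-≼ : ∀ {x r} → EqualLengths r → x ≼ r → EqualLengths x
  EqualLengths-≼ {x} {r} r-lengths (t , (c , fc) , r≡x+t) a b fa fb =
    +-cancelʳ-≡ (len c) (len a) (len b) (begin
      len a + len c  ≡⟨ len-⊕ a c ⟨
      len (a ⊕ c)    ≡⟨ r-lengths (a ⊕ c) (b ⊕ c) (extend a fa) (extend b fb) ⟩
      len (b ⊕ c)    ≡⟨ len-⊕ b c ⟩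
      len b + len c  ∎)
    where
    open ≡-Reasoning
    extend : ∀ a → IsFact n x a → IsFact n r (a ⊕ c)
    extend a fa = trans (IsFact-⊕ a c fa fc) (sym r≡x+t)

  path-preserves-len : ∀ {s a b} → AdjacentEqualLengths s → Path n s a b → IsFact n s a →
                       len a ≡ len b
  path-preserves-len adjacent here                fa = refl
  path-preserves-len adjacent (step fb ab≢0 path) fa =
    trans (adjacent _ _ fa fb ab≢0) (path-preserves-len adjacent path fb)

  Connected⇒EqualLengths : ∀ {s} → AdjacentEqualLengths s → Connected n s → EqualLengths s
  Connected⇒EqualLengths adjacent connected a b fa fb =
    path-preserves-len adjacent (connected a b fa fb) fa

  adjacent-equal-lengths : ∀ {s} → (∀ s′ j → s ≡ s′ + n j → EqualLengths s′) →
                           AdjacentEqualLengths s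
  adjacent-equal-lengths {s} below a b fa fb ab≢0
    with j , aⱼ>0 , bⱼ>0 ← shared-support a b ab≢0 = begin
    len a                   ≡⟨ len-⊖-basis a j aⱼ>0 ⟩
    len (a ⊖ basis j) + 1   ≡⟨ cong (_+ 1) (below s′ j s≡s′+nⱼ (a ⊖ basis j) (b ⊖ basis j) refl fb′) ⟩
    len (b ⊖ basis j) + 1   ≡⟨ len-⊖-basis b j bⱼ>0 ⟨
    len b                   ∎
    where
    open ≡-Reasoning
    s′ : ℕ
    s′ = dot (a ⊖ basis j) n
    s≡s′+nⱼ : s ≡ s′ + n j
    s≡s′+nⱼ = trans (sym fa) (dot-⊖-basis a n j aⱼ>0)
    fb′ : IsFact n s′ (b ⊖ basis j)
    fb′ = +-cancelʳ-≡ (n j) _ _ (trans (sym (dot-⊖-basis b n j bⱼ>0)) (trans fb s≡s′+nⱼ))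

  ULF⇒Ap-UBetti : ∀ {r} → ULF n r → Ap n (UBetti n) r
  ULF⇒Ap-UBetti (r∈S , r-lengths) =
    r∈S , λ { x ((x∈S , _) , x∉ULF) x≼r → x∉ULF (x∈S , EqualLengths-≼ r-lengths x≼r) }

  Ap-UBetti⇒ULF : (∀ j → 0 < n j) → ∀ {r} → Ap n (UBetti n) r → ULF n r
  Ap-UBetti⇒ULF generators-pos {r} (r∈S , no-UBetti-divisor) =
    r∈S , <-rec (λ s → s ≼ r → EqualLengths s) divisor-equal-lengths r ≼-refl
    where
    divisor-equal-lengths : ∀ s → (∀ {s′} → s′ < s → s′ ≼ r → EqualLengths s′) →
                            s ≼ r → EqualLengths s
    divisor-equal-lengths s ih s≼r a b fa fb = decidable-stable (len a ≟ len b) λ |a|≢|b| →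
      no-UBetti-divisor s (UBetti-by-lengths |a|≢|b|) s≼r
      where
      adjacent : AdjacentEqualLengths s
      adjacent = adjacent-equal-lengths λ s′ j s≡s′+nⱼ →
        ih (subst (s′ <_) (sym s≡s′+nⱼ) (m<m+n s′ (generators-pos j)))
           (≼-trans (n j , InS-generator j , s≡s′+nⱼ) s≼r)
      UBetti-by-lengths : len a ≢ len b → UBetti n s
      UBetti-by-lengths |a|≢|b| =
        ((a , fa) , λ connected → |a|≢|b| (Connected⇒EqualLengths adjacent connected a b fa fb))
        , λ s∈ULF → |a|≢|b| (proj₂ s∈ULF a b fa fb)

theorem4p1 : ∀ {e} (n : Vecℕ e) → IsNumericalSemigroupMinGens n →
             ∀ r → (ULF n r → Ap n (UBetti n) r) × (Ap n (UBetti n) r → ULF n r)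
theorem4p1 n (minimal , _) r =
  ULF⇒Ap-UBetti n , Ap-UBetti⇒ULF n (Minimal⇒generators-pos n minimal)
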